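{- Let $i,j,k,l$ be positive integers with $j\ge k\ge 2$ and $i>k$. Then $\mathcal{G}_{\langle i,j\rangle}\not\subseteq\mathcal{G}_{\langle k,l\rangle}$.
   Context: All digraphs are finite, without loops and without parallel arcs; all graphs are finite and simple. The competition graph of a digraph $D$ has vertex set $V(D)$ and an edge $uv$ ($u\ne v$) iff $u$ and $v$ have a common out-neighbor in $D$. For positive integers $i,j$, an $\langle i,j\rangle$ digraph is a loopless digraph in which every vertex has indegree at most $i$ and outdegree at most $j$. An $\langle i,j\rangle$ competition graph is the competition graph of some $\langle i,j\rangle$ digraph, and $\mathcal{G}_{\langle i,j\rangle}$ denotes the family of all $\langle i,j\rangle$ competition graphs. -}

module Defs where

open import Data.Nat using (ℕ; _≤_)
open import Data.Bool using (Bool; true; false; T; _∧_)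
open import Data.Fin using (Fin)
open import Data.List using (List; filter; length)
open import Data.Product using (Σ; ∃; ∃-syntax; _×_; _,_)
open import Relation.Nullary using (¬_)
open import Relation.Binary.PropositionalEquality using (_≡_; _≢_)
open import Data.List using (allFin)
open import Data.Bool.Properties using (T?)

record Digraph (n : ℕ) : Set where
  field
    arc      : Fin n → Fin n → Bool
    loopless : ∀ v → arc v v ≡ false
open Digraph public

record Graph (n : ℕ) : Set where
  field
    adj       : Fin n → Fin n → Bool
    irrefl    : ∀ v → adj v v ≡ false
    symmetric : ∀ u v → adj u v ≡ adj v u
open Graph public

count : ∀ {n} → (Fin n → Bool) → ℕ
count {n} p = length (filter (λ x → T? (p x)) (allFin n))

outdeg : ∀ {n} → Digraph n → Fin n → ℕ
outdeg D u = count (λ v → arc D u v)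

indeg : ∀ {n} → Digraph n → Fin n → ℕ
indeg D v = count (λ u → arc D u v)

IsIJDigraph : ℕ → ℕ → ∀ {n} → Digraph n → Set
IsIJDigraph i j D = ∀ v → (indeg D v ≤ i) × (outdeg D v ≤ j)

IsCompetitionGraphOf : ∀ {n} → Graph n → Digraph n → Set
IsCompetitionGraphOf {n} G D =
  ∀ u v → (T (adj G u v) → (u ≢ v × ∃[ w ] (T (arc D u w) × T (arc D v w))))
        × ((u ≢ v × ∃[ w ] (T (arc D u w) × T (arc D v w))) → T (adj G u v))

InFamily : ℕ → ℕ → ∀ {n} → Graph n → Set
InFamily i j {n} G = ∃[ D ] (IsIJDigraph i j {n} D × IsCompetitionGraphOf G D)

-- Non-adjacent vertices of a competition graph never share a prey, and in a ⟨k,l⟩ digraph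
-- a prey has at most k in-neighbours.  Hence in a ⟨2,l⟩ digraph every edge of
-- K₄ minus an edge has its own prey: five prey on four vertices.  For k ≥ 3 take a clique on
-- the k+1 vertices Q, hubs A, B, Y and leaves X₀ … X_{k-1}, where A and B are joined to every
-- leaf and Y to X₀ and X₁.  In a ⟨k,l⟩ digraph the clique needs three prey, and each of the
-- 2k+2 edges of the triangle-free part needs a prey of its own, distinct from the clique's:
-- 2k+5 prey on 2k+4 vertices.  With indegree k+1 allowed, a single vertex can serve the whole
-- clique, which leaves just enough room to realise the graph with outdegree at most k.
module Submission where

open import Defs
open import Data.Nat using (ℕ; suc; _+_; _≤_; _<_; _≤ᵇ_; z≤n; s≤s)
open import Data.Nat.Properties using (≤-trans; ≤-reflexive; 1+n≢n; 1+n≰n)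
open import Data.Bool using (Bool; T; _∧_; not)
open import Data.Bool.Properties using (T?)
open import Data.Empty using (⊥)
open import Data.Unit using (⊤; tt)
open import Data.Fin using (Fin; zero; suc; _≟_; toℕ; fromℕ; inject₁; splitAt; _↑ˡ_; _↑ʳ_)
open import Data.Fin.Patterns using (0F; 1F; 2F; 3F)
open import Data.Fin.Properties
  using (injective⇒≤; any?; ¬∀⟶∃¬; toℕ-inject₁; splitAt-↑ˡ; splitAt-↑ʳ; join-splitAt)
open import Data.Fin.Relation.Unary.Top using (view; ‵fromℕ; ‵inj₁; view-fromℕ; view-inject₁)
open import Data.Sum using ([_,_]′; inj₁; inj₂)
open import Data.List using (List; []; _∷_; _++_; length; filter; allFin; lookup; tabulate; map; concat)
open import Data.List.Properties using (length-map; length-tabulate; length-++; ++-identityʳ)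
open import Data.List.Membership.Propositional using (_∈_; _∉_)
open import Data.List.Membership.Propositional.Properties
  using (∈-lookup; ∈-filter⁺; ∈-filter⁻; ∈-allFin; ∈-map⁺; ∈-tabulate⁺; ∈-tabulate⁻)
open import Data.List.Membership.Setoid.Properties using (index-injective)
open import Data.List.Relation.Binary.Disjoint.Propositional using (Disjoint)
open import Data.List.Relation.Binary.Subset.Propositional using (_⊆_)
open import Data.List.Relation.Unary.Any using (here; there)
open import Data.List.Relation.Unary.All as All using (All; []; _∷_)
import Data.List.Relation.Unary.All.Properties as All
open import Data.List.Relation.Unary.AllPairs using (AllPairs; []; _∷_)
open import Data.List.Relation.Unary.Unique.Propositional using (Unique)
import Data.List.Relation.Unary.Unique.Propositional.Properties as Unique
open import Data.Product using (∃-syntax; _×_; _,_; proj₁; proj₂)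
open import Function.Base using (_∘_)
open import Function.Bundles using (mk⇔)
open import Function.Definitions using (Injective)
open import Relation.Binary.Definitions using (DecidableEquality)
open import Relation.Nullary using (¬_; Dec; contradiction)
open import Relation.Nullary.Decidable
  using (isYes; False; map′; toWitness; fromWitness; toWitnessFalse; ¬?; _×-dec_;
         does-⇔; isYes≗does; dec-false; decidable-stable)
open import Relation.Binary.PropositionalEquality
  using (_≡_; _≢_; refl; sym; trans; cong; cong₂; subst; subst₂; setoid; ≢-sym; module ≡-Reasoning)

-- Counting distinct elements

module _ {a} {A : Set a} where

  lookup-injective : ∀ {xs : List A} → Unique xs → Injective _≡_ _≡_ (lookup xs)
  lookup-injective (_ ∷ _)       {zero}  {zero}  _  = refl
  lookup-injective (x∉xs ∷ _)    {zero}  {suc j} eq = contradiction eq (All.lookup x∉xs (∈-lookup j))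
  lookup-injective (x∉xs ∷ _)    {suc i} {zero}  eq = contradiction (sym eq) (All.lookup x∉xs (∈-lookup i))
  lookup-injective (_ ∷ xs-uniq) {suc i} {suc j} eq = cong suc (lookup-injective xs-uniq eq)

  Unique-⊆⇒length≤ : ∀ {xs ys : List A} → Unique xs → xs ⊆ ys → length xs ≤ length ys
  Unique-⊆⇒length≤ xs-uniq xs⊆ys = injective⇒≤ λ eq →
    lookup-injective xs-uniq (index-injective (setoid A) (xs⊆ys (∈-lookup _)) (xs⊆ys (∈-lookup _)) eq)

Unique⇒length≤ : ∀ {n} {xs : List (Fin n)} → Unique xs → length xs ≤ n
Unique⇒length≤ xs-uniq = injective⇒≤ (lookup-injective xs-uniq)

module _ {n} (p : Fin n → Bool) where

  private
    satisfiers-unique : Unique (filter (λ x → T? (p x)) (allFin n))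
    satisfiers-unique = Unique.filter⁺ (λ x → T? (p x)) (Unique.allFin⁺ n)

  count≤length : ∀ {xs} → (∀ {x} → T (p x) → x ∈ xs) → count p ≤ length xs
  count≤length px⇒x∈xs = Unique-⊆⇒length≤ satisfiers-unique
    (λ x∈ → px⇒x∈xs (proj₂ (∈-filter⁻ (λ x → T? (p x)) {xs = allFin n} x∈)))

  length≤count : ∀ {xs} → Unique xs → (∀ {x} → x ∈ xs → T (p x)) → length xs ≤ count p
  length≤count xs-uniq x∈xs⇒px =
    Unique-⊆⇒length≤ xs-uniq (λ {x} x∈ → ∈-filter⁺ (λ x → T? (p x)) (∈-allFin x) (x∈xs⇒px x∈))

-- Competition graphs

module _ {n} (D : Digraph n) where

  CommonPrey : Fin n → Fin n → Set
  CommonPrey u v = ∃[ w ] (T (arc D u w) × T (arc D v w))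

  Competing : Fin n → Fin n → Set
  Competing u v = u ≢ v × CommonPrey u v

  competing? : ∀ u v → Dec (Competing u v)
  competing? u v = ¬? (u ≟ v) ×-dec any? (λ w → T? (arc D u w) ×-dec T? (arc D v w))

  competitionGraph : Graph n
  competitionGraph = record
    { adj       = λ u v → isYes (competing? u v)
    ; irrefl    = λ v → trans (isYes≗does (competing? v v))
                              (dec-false (competing? v v) λ (v≢v , _) → v≢v refl)
    ; symmetric = λ u v → trans (isYes≗does (competing? u v))
                            (trans (does-⇔ (mk⇔ flip flip) (competing? u v) (competing? v u))
                                   (sym (isYes≗does (competing? v u))))
    }
    where
    flip : ∀ {u v} → Competing u v → Competing v u
    flip (u≢v , w , uw , vw) = ≢-sym u≢v , w , vw , uw

  competitionGraph-isCompetitionGraph : IsCompetitionGraphOf competitionGraph D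
  competitionGraph-isCompetitionGraph u v = toWitness , fromWitness

competitionGraph∈family : ∀ {i j n} (D : Digraph n) → IsIJDigraph i j D → InFamily i j (competitionGraph D)
competitionGraph∈family D deg = D , deg , competitionGraph-isCompetitionGraph D

IsIJDigraph-mono : ∀ {i i′ j j′ n} {D : Digraph n} → i ≤ i′ → j ≤ j′ →
                   IsIJDigraph i j D → IsIJDigraph i′ j′ D
IsIJDigraph-mono i≤i′ j≤j′ deg v = ≤-trans (proj₁ (deg v)) i≤i′ , ≤-trans (proj₂ (deg v)) j≤j′

in-neighbours-length≤ : ∀ {i j n} (D : Digraph n) → IsIJDigraph i j D → ∀ {w us} → Unique us →
                        (∀ {u} → u ∈ us → T (arc D u w)) → length us ≤ i
in-neighbours-length≤ D deg {w} us-uniq us→w =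
  ≤-trans (length≤count (λ u → arc D u w) us-uniq us→w) (proj₁ (deg w))

separates : ∀ {n} (D : Digraph n) {u w w′} → ¬ T (arc D u w) → T (arc D u w′) → w ≢ w′
separates _ ¬uw uw′ refl = ¬uw uw′

module CompetitionGraph {n} (G : Graph n) (D : Digraph n) (isCompetitionGraph : IsCompetitionGraphOf G D) where

  commonPrey : ∀ u v → T (adj G u v) → CommonPrey D u v
  commonPrey u v uv = proj₂ (proj₁ (isCompetitionGraph u v) uv)

  prey : ∀ u v → T (adj G u v) → Fin n
  prey u v uv = proj₁ (commonPrey u v uv)

  prey₁ : ∀ u v (uv : T (adj G u v)) → T (arc D u (prey u v uv))
  prey₁ u v uv = proj₁ (proj₂ (commonPrey u v uv))

  prey₂ : ∀ u v (uv : T (adj G u v)) → T (arc D v (prey u v uv))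
  prey₂ u v uv = proj₂ (proj₂ (commonPrey u v uv))

  adj⇒≢ : ∀ {u v} → T (adj G u v) → u ≢ v
  adj⇒≢ uv = proj₁ (proj₁ (isCompetitionGraph _ _) uv)

  commonPrey⇒adj : ∀ {u v w} → u ≢ v → T (arc D u w) → T (arc D v w) → T (adj G u v)
  commonPrey⇒adj u≢v uw vw = proj₂ (isCompetitionGraph _ _) (u≢v , _ , uw , vw)

  ¬adj⇒¬commonPrey : ∀ {u v w} → u ≢ v → ¬ T (adj G u v) → T (arc D u w) → ¬ T (arc D v w)
  ¬adj⇒¬commonPrey u≢v ¬uv uw vw = ¬uv (commonPrey⇒adj u≢v uw vw)

-- Every prey misses a member of the clique K, since K has more members than a prey has
-- in-neighbours.  So the prey w₁ of K 0, K 1 misses some K q₁, the prey w₂ of K q₁, K 0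
-- misses some K q₂, and w₁, w₂ and the prey w₃ of K q₁, K q₂ are pairwise distinct.
module LargeClique {n k l} (G : Graph n) (D : Digraph n) (deg : IsIJDigraph (suc k) l D)
                   (isCompetitionGraph : IsCompetitionGraphOf G D)
                   (K : Fin (2 + k) → Fin n) (K-injective : Injective _≡_ _≡_ K)
                   (K-clique : ∀ {a b} → a ≢ b → T (adj G (K a) (K b))) where

  open CompetitionGraph G D isCompetitionGraph

  misses : ∀ w → ∃[ q ] ¬ T (arc D (K q) w)
  misses w = ¬∀⟶∃¬ (2 + k) _ (λ q → T? (arc D (K q) w)) λ K→w →
    1+n≰n (subst (_≤ suc k) (length-tabulate K)
                 (in-neighbours-length≤ D deg {w} {tabulate K} (Unique.tabulate⁺ K-injective) (K-in-neighbours K→w)))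
    where
    K-in-neighbours : ∀ {w} → (∀ q → T (arc D (K q) w)) → ∀ {u} → u ∈ tabulate K → T (arc D u w)
    K-in-neighbours K→w u∈ with ∈-tabulate⁻ {f = K} u∈
    ... | q , refl = K→w q

  private
    missed≢feeder : ∀ {w q} → T (arc D (K q) w) → proj₁ (misses w) ≢ q
    missed≢feeder {w} Kq→w eq = proj₂ (misses w) (subst (λ q → T (arc D (K q) w)) (sym eq) Kq→w)

    w₁ : Fin n
    w₁ = prey (K 0F) (K 1F) (K-clique λ ())

    q₁ : Fin (2 + k)
    q₁ = proj₁ (misses w₁)

    q₁≢0 : q₁ ≢ 0F
    q₁≢0 = missed≢feeder (prey₁ _ _ _)

    w₂ : Fin n
    w₂ = prey (K q₁) (K 0F) (K-clique q₁≢0)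

    q₂ : Fin (2 + k)
    q₂ = proj₁ (misses w₂)

    q₁≢q₂ : q₁ ≢ q₂
    q₁≢q₂ = ≢-sym (missed≢feeder (prey₁ _ _ _))

    w₃ : Fin n
    w₃ = prey (K q₁) (K q₂) (K-clique q₁≢q₂)

  preys : List (Fin n)
  preys = w₁ ∷ w₂ ∷ w₃ ∷ []

  preys-unique : Unique preys
  preys-unique = (separates D (proj₂ (misses w₁)) (prey₁ _ _ _)
                 ∷ separates D (proj₂ (misses w₁)) (prey₁ _ _ _) ∷ [])
               ∷ (separates D (proj₂ (misses w₂)) (prey₂ _ _ _) ∷ [])
               ∷ [] ∷ []

  preys-fed : All (λ w → ∃[ q ] T (arc D (K q) w)) preys
  preys-fed = (0F , prey₁ _ _ _) ∷ (0F , prey₂ _ _ _) ∷ (q₁ , prey₁ _ _ _) ∷ []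

module InNeighbourLists {n} {V : Set} (enc : V → Fin n) (dec : Fin n → V)
                        (dec-enc : ∀ v → dec (enc v) ≡ v) (enc-dec : ∀ u → enc (dec u) ≡ u)
                        (inN : V → List V) (inN-irreflexive : ∀ v → v ∉ inN v) where

  enc-injective : Injective _≡_ _≡_ enc
  enc-injective {a} {b} eq = trans (sym (dec-enc a)) (trans (cong dec eq) (dec-enc b))

  _≟V_ : DecidableEquality V
  a ≟V b = map′ enc-injective (cong enc) (enc a ≟ enc b)

  open import Data.List.Membership.DecPropositional _≟V_ using (_∈?_)

  digraph : Digraph n
  digraph = record
    { arc      = λ u w → isYes (dec u ∈? inN (dec w))
    ; loopless = λ v → trans (isYes≗does (dec v ∈? _)) (dec-false (dec v ∈? _) (inN-irreflexive (dec v)))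
    }

  arc⇒∈ : ∀ {u w} → T (arc digraph u w) → dec u ∈ inN (dec w)
  arc⇒∈ = toWitness

  ∈⇒arc : ∀ {a c} → a ∈ inN c → T (arc digraph (enc a) (enc c))
  ∈⇒arc {a} {c} a∈ rewrite dec-enc a | dec-enc c = fromWitness a∈

  private
    ∈-map-enc : ∀ {u vs} → dec u ∈ vs → u ∈ map enc vs
    ∈-map-enc {u} u∈ = subst (_∈ _) (enc-dec u) (∈-map⁺ enc u∈)

  indeg≤ : ∀ w → indeg digraph w ≤ length (inN (dec w))
  indeg≤ w = subst (indeg digraph w ≤_) (length-map enc (inN (dec w)))
                   (count≤length (λ u → arc digraph u w) (λ uw → ∈-map-enc (arc⇒∈ uw)))

  outdeg≤ : (outN : V → List V) → (∀ {a c} → a ∈ inN c → c ∈ outN a) →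
            ∀ u → outdeg digraph u ≤ length (outN (dec u))
  outdeg≤ outN in⇒out u = subst (outdeg digraph u ≤_) (length-map enc (outN (dec u)))
                                (count≤length (λ w → arc digraph u w) (λ uw → ∈-map-enc (in⇒out (arc⇒∈ uw))))

  open CompetitionGraph (competitionGraph digraph) digraph (competitionGraph-isCompetitionGraph digraph)
    using (commonPrey; commonPrey⇒adj)

  shared⇒adj : ∀ {a b c} → a ≢ b → a ∈ inN c → b ∈ inN c →
               T (adj (competitionGraph digraph) (enc a) (enc b))
  shared⇒adj a≢b a∈ b∈ = commonPrey⇒adj (a≢b ∘ enc-injective) (∈⇒arc a∈) (∈⇒arc b∈)

  adj⇒shared : ∀ {a b} → T (adj (competitionGraph digraph) (enc a) (enc b)) → ∃[ c ] (a ∈ inN c × b ∈ inN c)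
  adj⇒shared {a} {b} ab with commonPrey _ _ ab
  ... | w , aw , bw = dec w , subst (_∈ _) (dec-enc a) (arc⇒∈ aw) , subst (_∈ _) (dec-enc b) (arc⇒∈ bw)

-- The case k = 2

-- Its competition graph is K₄ minus the edge 23.
D₄ : Digraph 4
D₄ = record
  { arc      = λ u v → (2 ≤ᵇ toℕ v) ∧ not (isYes (u ≟ v))
  ; loopless = λ { 0F → refl ; 1F → refl ; 2F → refl ; 3F → refl }
  }

D₄-degrees : IsIJDigraph 3 2 D₄
D₄-degrees 0F = z≤n , s≤s (s≤s z≤n)
D₄-degrees 1F = z≤n , s≤s (s≤s z≤n)
D₄-degrees 2F = s≤s (s≤s (s≤s z≤n)) , s≤s z≤n
D₄-degrees 3F = s≤s (s≤s (s≤s z≤n)) , s≤s z≤n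

G₄ : Graph 4
G₄ = competitionGraph D₄

G₄∉family : ∀ l → ¬ InFamily 2 l G₄
G₄∉family l (D , deg , isCompetitionGraph) = 1+n≰n (Unique⇒length≤ preys-unique)
  where
  open CompetitionGraph G₄ D isCompetitionGraph

  no-third-in-neighbour : ∀ x y z (xy : T (adj G₄ x y)) → False (z ≟ x) → False (z ≟ y) →
                          ¬ T (arc D z (prey x y xy))
  no-third-in-neighbour x y z xy z≢x z≢y zw = 3≰2 (in-neighbours-length≤ D deg xyz-unique xyz→prey)
    where
    xyz-unique : Unique (x ∷ y ∷ z ∷ [])
    xyz-unique = (adj⇒≢ xy ∷ ≢-sym (toWitnessFalse {a? = z ≟ x} z≢x) ∷ [])
               ∷ (≢-sym (toWitnessFalse {a? = z ≟ y} z≢y) ∷ []) ∷ [] ∷ []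
    xyz→prey : ∀ {u} → u ∈ x ∷ y ∷ z ∷ [] → T (arc D u (prey x y xy))
    xyz→prey (here refl)                 = prey₁ x y xy
    xyz→prey (there (here refl))         = prey₂ x y xy
    xyz→prey (there (there (here refl))) = zw
    3≰2 : ¬ 3 ≤ 2
    3≰2 (s≤s (s≤s ()))

  -- Stated with decided inequalities, which evaluation discharges at the closed vertices below.
  prey≢ : ∀ x y z {w} {xy : T (adj G₄ x y)} {z≢x : False (z ≟ x)} {z≢y : False (z ≟ y)} →
          T (arc D z w) → prey x y xy ≢ w
  prey≢ x y z {xy = xy} {z≢x} {z≢y} = separates D (no-third-in-neighbour x y z xy z≢x z≢y)

  preys-unique : Unique (prey 0F 1F _ ∷ prey 0F 2F _ ∷ prey 0F 3F _ ∷ prey 1F 2F _ ∷ prey 1F 3F _ ∷ [])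
  preys-unique =
      (prey≢ 0F 1F 2F (prey₂ 0F 2F _) ∷ prey≢ 0F 1F 3F (prey₂ 0F 3F _)
     ∷ prey≢ 0F 1F 2F (prey₂ 1F 2F _) ∷ prey≢ 0F 1F 3F (prey₂ 1F 3F _) ∷ [])
    ∷ (prey≢ 0F 2F 3F (prey₂ 0F 3F _) ∷ prey≢ 0F 2F 1F (prey₁ 1F 2F _)
     ∷ prey≢ 0F 2F 1F (prey₁ 1F 3F _) ∷ [])
    ∷ (prey≢ 0F 3F 1F (prey₁ 1F 2F _) ∷ prey≢ 0F 3F 1F (prey₁ 1F 3F _) ∷ [])
    ∷ (prey≢ 1F 2F 3F (prey₂ 1F 3F _) ∷ [])
    ∷ [] ∷ []

-- The case k ≥ 3

suc≢inject₁ : ∀ {n} (t : Fin n) → suc t ≢ inject₁ t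
suc≢inject₁ t eq = 1+n≢n (trans (cong toℕ eq) (toℕ-inject₁ t))

module Construction (m : ℕ) where

  k : ℕ
  k = 3 + m

  data V : Set where
    A B Y : V
    Q : Fin (suc k) → V
    X : Fin k → V

  X-injective : ∀ {s s′} → X s ≡ X s′ → s ≡ s′
  X-injective refl = refl

  Q-injective : ∀ {q q′} → Q q ≡ Q q′ → q ≡ q′
  Q-injective refl = refl

  n : ℕ
  n = 3 + (suc k + k)

  enc : V → Fin n
  enc A     = 0F
  enc B     = 1F
  enc Y     = 2F
  enc (Q q) = suc (suc (suc (q ↑ˡ k)))
  enc (X s) = suc (suc (suc (suc k ↑ʳ s)))

  dec : Fin n → V
  dec 0F                  = A
  dec 1F                  = B
  dec 2F                  = Y
  dec (suc (suc (suc r))) = [ Q , X ]′ (splitAt (suc k) r)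

  dec-enc : ∀ v → dec (enc v) ≡ v
  dec-enc A     = refl
  dec-enc B     = refl
  dec-enc Y     = refl
  dec-enc (Q q) rewrite splitAt-↑ˡ (suc k) q k = refl
  dec-enc (X s) rewrite splitAt-↑ʳ (suc k) k s = refl

  enc-dec : ∀ u → enc (dec u) ≡ u
  enc-dec 0F = refl
  enc-dec 1F = refl
  enc-dec 2F = refl
  enc-dec (suc (suc (suc r))) with splitAt (suc k) r | join-splitAt (suc k) k r
  ... | inj₁ _ | eq = cong (λ u → suc (suc (suc u))) eq
  ... | inj₂ _ | eq = cong (λ u → suc (suc (suc u))) eq

  last : Fin k
  last = fromℕ (2 + m)

  -- A is the prey of the clique, Q (1+s) of A and X s, X (1+t) of B and X t, Q 0 of B and
  -- X last, and B, X 0 are the prey of Y with X 0, X 1.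
  inN : V → List V
  inN A           = tabulate Q
  inN B           = Y ∷ X 0F ∷ []
  inN Y           = []
  inN (Q 0F)      = B ∷ X last ∷ []
  inN (Q (suc s)) = A ∷ X s ∷ []
  inN (X 0F)      = Y ∷ X 1F ∷ []
  inN (X (suc t)) = B ∷ X (inject₁ t) ∷ []

  inN-irreflexive : ∀ v → v ∉ inN v
  inN-irreflexive A A∈ with ∈-tabulate⁻ {f = Q} A∈
  ... | _ , ()
  inN-irreflexive B           (there (there ()))
  inN-irreflexive (Q 0F)      (there (there ()))
  inN-irreflexive (Q (suc _)) (there (there ()))
  inN-irreflexive (X 0F)      (there (there ()))
  inN-irreflexive (X (suc t)) (there (here eq)) = suc≢inject₁ t (X-injective eq)
  inN-irreflexive (X (suc _)) (there (there ()))

  preyOfBX : Fin k → V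
  preyOfBX s with view s
  ... | ‵fromℕ          = Q 0F
  ... | ‵inj₁ {i = t} _ = X (suc t)

  preyOfBX-in-neighbours : ∀ s → B ∈ inN (preyOfBX s) × X s ∈ inN (preyOfBX s)
  preyOfBX-in-neighbours s with view s
  ... | ‵fromℕ  = here refl , there (here refl)
  ... | ‵inj₁ _ = here refl , there (here refl)

  preyOfYX : Fin k → List V
  preyOfYX 0F            = B ∷ []
  preyOfYX 1F            = X 0F ∷ []
  preyOfYX (suc (suc _)) = []

  outN : V → List V
  outN A     = tabulate (Q ∘ suc)
  outN B     = Q 0F ∷ tabulate (X ∘ suc)
  outN Y     = B ∷ X 0F ∷ []
  outN (Q _) = A ∷ []
  outN (X s) = Q (suc s) ∷ preyOfBX s ∷ preyOfYX s

  in⇒out : ∀ {a c} → a ∈ inN c → c ∈ outN a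
  in⇒out {c = A} a∈ with ∈-tabulate⁻ {f = Q} a∈
  ... | _ , refl = here refl
  in⇒out {c = B}         (here refl)         = here refl
  in⇒out {c = B}         (there (here refl)) = there (there (here refl))
  in⇒out {c = Q 0F}      (here refl)         = here refl
  in⇒out {c = Q 0F}      (there (here refl)) rewrite view-fromℕ (2 + m) = there (here refl)
  in⇒out {c = Q (suc s)} (here refl)         = ∈-tabulate⁺ {f = Q ∘ suc} s
  in⇒out {c = Q (suc s)} (there (here refl)) = here refl
  in⇒out {c = X 0F}      (here refl)         = there (here refl)
  in⇒out {c = X 0F}      (there (here refl)) = there (there (here refl))
  in⇒out {c = X (suc t)} (here refl)         = there (∈-tabulate⁺ {f = X ∘ suc} t)
  in⇒out {c = X (suc t)} (there (here refl)) rewrite view-inject₁ t = there (here refl)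

  inN-length : ∀ c → length (inN c) ≤ suc k
  inN-length A           = ≤-reflexive (length-tabulate Q)
  inN-length B           = s≤s (s≤s z≤n)
  inN-length Y           = z≤n
  inN-length (Q 0F)      = s≤s (s≤s z≤n)
  inN-length (Q (suc _)) = s≤s (s≤s z≤n)
  inN-length (X 0F)      = s≤s (s≤s z≤n)
  inN-length (X (suc _)) = s≤s (s≤s z≤n)

  outN-length : ∀ a → length (outN a) ≤ k
  outN-length A                 = ≤-reflexive (length-tabulate (Q ∘ suc))
  outN-length B                 = s≤s (≤-reflexive (length-tabulate (X ∘ suc)))
  outN-length Y                 = s≤s (s≤s z≤n)
  outN-length (Q _)             = s≤s z≤n
  outN-length (X 0F)            = s≤s (s≤s (s≤s z≤n))
  outN-length (X 1F)            = s≤s (s≤s (s≤s z≤n))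
  outN-length (X (suc (suc _))) = s≤s (s≤s z≤n)

  open InNeighbourLists enc dec dec-enc enc-dec inN inN-irreflexive

  digraph-degrees : IsIJDigraph (suc k) k digraph
  digraph-degrees u = ≤-trans (indeg≤ u) (inN-length (dec u)) , ≤-trans (outdeg≤ outN in⇒out u) (outN-length (dec u))

  G : Graph n
  G = competitionGraph digraph

  G∈family : ∀ {i j} → k < i → k ≤ j → InFamily i j G
  G∈family k<i k≤j = competitionGraph∈family digraph (IsIJDigraph-mono {D = digraph} k<i k≤j digraph-degrees)

  data Role : Set where
    clique hub leaf : Role

  role : V → Role
  role (Q _) = clique
  role (X _) = leaf
  role _     = hub

  Compatible : Role → Role → Set
  Compatible clique clique = ⊤
  Compatible hub    leaf   = ⊤
  Compatible leaf   hub    = ⊤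
  Compatible _      _      = ⊥

  hub-leaf-compatible : ∀ {h x a b} → role h ≡ hub → role x ≡ leaf →
                        a ∈ h ∷ x ∷ [] → b ∈ h ∷ x ∷ [] → a ≢ b → Compatible (role a) (role b)
  hub-leaf-compatible _  _  (here refl)         (here refl)         a≢b = contradiction refl a≢b
  hub-leaf-compatible _  _  (there (here refl)) (there (here refl)) a≢b = contradiction refl a≢b
  hub-leaf-compatible rh rx (here refl)         (there (here refl)) _   = subst₂ Compatible (sym rh) (sym rx) tt
  hub-leaf-compatible rh rx (there (here refl)) (here refl)         _   = subst₂ Compatible (sym rx) (sym rh) tt

  shared-compatible : ∀ {a b c} → a ∈ inN c → b ∈ inN c → a ≢ b → Compatible (role a) (role b)
  shared-compatible {c = A} a∈ b∈ _ with ∈-tabulate⁻ {f = Q} a∈ | ∈-tabulate⁻ {f = Q} b∈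
  ... | _ , refl | _ , refl = tt
  shared-compatible {c = B}         = hub-leaf-compatible refl refl
  shared-compatible {c = Q 0F}      = hub-leaf-compatible refl refl
  shared-compatible {c = Q (suc _)} = hub-leaf-compatible refl refl
  shared-compatible {c = X 0F}      = hub-leaf-compatible refl refl
  shared-compatible {c = X (suc _)} = hub-leaf-compatible refl refl

  incompatible⇒¬adj : ∀ {a b} → a ≢ b → ¬ Compatible (role a) (role b) → ¬ T (adj G (enc a) (enc b))
  incompatible⇒¬adj a≢b incompatible ab = incompatible (shared a≢b (adj⇒shared ab))
    where
    shared : ∀ {a b} → a ≢ b → ∃[ c ] (a ∈ inN c × b ∈ inN c) → Compatible (role a) (role b)
    shared a≢b (c , a∈ , b∈) = shared-compatible {c = c} a∈ b∈ a≢b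

  Q-adj : ∀ {q q′} → q ≢ q′ → T (adj G (enc (Q q)) (enc (Q q′)))
  Q-adj {q} {q′} q≢q′ =
    shared⇒adj {Q q} {Q q′} {A} (q≢q′ ∘ Q-injective) (∈-tabulate⁺ {f = Q} q) (∈-tabulate⁺ {f = Q} q′)

  AX-adj : ∀ s → T (adj G (enc A) (enc (X s)))
  AX-adj s = shared⇒adj {A} {X s} {Q (suc s)} (λ ()) (here refl) (there (here refl))

  BX-adj : ∀ s → T (adj G (enc B) (enc (X s)))
  BX-adj s = shared⇒adj {B} {X s} {preyOfBX s} (λ ())
                        (proj₁ (preyOfBX-in-neighbours s)) (proj₂ (preyOfBX-in-neighbours s))

  YX₀-adj : T (adj G (enc Y) (enc (X 0F)))
  YX₀-adj = shared⇒adj {Y} {X 0F} {B} (λ ()) (here refl) (there (here refl))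

  YX₁-adj : T (adj G (enc Y) (enc (X 1F)))
  YX₁-adj = shared⇒adj {Y} {X 1F} {X 0F} (λ ()) (here refl) (there (here refl))

  G∉family : ∀ l → ¬ InFamily k l G
  G∉family l (D , deg , isCompetitionGraph) = 1+n≰n (subst (_≤ n) preys-length (Unique⇒length≤ preys-unique))
    where
    open CompetitionGraph G D isCompetitionGraph

    starved : ∀ {a b w} → a ≢ b → ¬ Compatible (role a) (role b) → T (arc D (enc a) w) → ¬ T (arc D (enc b) w)
    starved a≢b incompatible = ¬adj⇒¬commonPrey (a≢b ∘ enc-injective) (incompatible⇒¬adj a≢b incompatible)

    FedBy : (V → Set) → Fin n → Set
    FedBy P w = ∃[ a ] (P a × T (arc D (enc a) w))

    fed-disjoint : ∀ {P P′ : V → Set} →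
                   (∀ {a b} → P a → P′ b → a ≢ b × ¬ Compatible (role a) (role b)) →
                   ∀ {xs ys} → All (FedBy P) xs → All (FedBy P′) ys → Disjoint xs ys
    fed-disjoint separated fed-xs fed-ys (w∈xs , w∈ys) with All.lookup fed-xs w∈xs | All.lookup fed-ys w∈ys
    ... | a , Pa , aw | b , P′b , bw = starved (proj₁ (separated Pa P′b)) (proj₂ (separated Pa P′b)) aw bw

    leaf-preys-injective : (p : Fin k → Fin n) → (∀ s → T (arc D (enc (X s)) (p s))) → Injective _≡_ _≡_ p
    leaf-preys-injective p fed {s} {s′} eq = decidable-stable (s ≟ s′) λ s≢s′ →
      contradiction eq (separates D (starved {X s} {X s′} (s≢s′ ∘ X-injective) (λ ()) (fed s)) (fed s′))

    open LargeClique G D deg isCompetitionGraph (enc ∘ Q) (Q-injective ∘ enc-injective) Q-adj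
      renaming (preys to clique-preys; preys-unique to clique-preys-unique; preys-fed to clique-preys-fed)

    preyAX preyBX : Fin k → Fin n
    preyAX s = prey (enc A) (enc (X s)) (AX-adj s)
    preyBX s = prey (enc B) (enc (X s)) (BX-adj s)

    Y-preys : List (Fin n)
    Y-preys = prey (enc Y) (enc (X 0F)) YX₀-adj ∷ prey (enc Y) (enc (X 1F)) YX₁-adj ∷ []

    blocks : List (List (Fin n))
    blocks = Y-preys ∷ clique-preys ∷ tabulate preyAX ∷ tabulate preyBX ∷ []

    Y-preys-unique : Unique Y-preys
    Y-preys-unique =
      (separates D (starved {X 0F} {X 1F} (λ ()) (λ ()) (prey₂ (enc Y) (enc (X 0F)) YX₀-adj))
                   (prey₂ (enc Y) (enc (X 1F)) YX₁-adj) ∷ []) ∷ [] ∷ []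

    Y-fed : All (FedBy (_≡ Y)) Y-preys
    Y-fed = (Y , refl , prey₁ (enc Y) (enc (X 0F)) YX₀-adj)
          ∷ (Y , refl , prey₁ (enc Y) (enc (X 1F)) YX₁-adj) ∷ []

    clique-fed : All (FedBy (λ a → ∃[ q ] a ≡ Q q)) clique-preys
    clique-fed = All.map (λ (q , Kq→w) → Q q , (q , refl) , Kq→w) clique-preys-fed

    AX-fed : All (FedBy (_≡ A)) (tabulate preyAX)
    AX-fed = All.tabulate⁺ (λ s → A , refl , prey₁ (enc A) (enc (X s)) (AX-adj s))

    BX-fed : All (FedBy (_≡ B)) (tabulate preyBX)
    BX-fed = All.tabulate⁺ (λ s → B , refl , prey₁ (enc B) (enc (X s)) (BX-adj s))

    blocks-unique : All Unique blocks
    blocks-unique =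
        Y-preys-unique
      ∷ clique-preys-unique
      ∷ Unique.tabulate⁺ {f = preyAX} (leaf-preys-injective preyAX λ s → prey₂ (enc A) (enc (X s)) (AX-adj s))
      ∷ Unique.tabulate⁺ {f = preyBX} (leaf-preys-injective preyBX λ s → prey₂ (enc B) (enc (X s)) (BX-adj s))
      ∷ []

    blocks-disjoint : AllPairs Disjoint blocks
    blocks-disjoint =
        (fed-disjoint (λ { refl (_ , refl) → (λ ()) , (λ ()) }) Y-fed clique-fed
       ∷ fed-disjoint (λ { refl refl → (λ ()) , (λ ()) }) Y-fed AX-fed
       ∷ fed-disjoint (λ { refl refl → (λ ()) , (λ ()) }) Y-fed BX-fed ∷ [])
      ∷ (fed-disjoint (λ { (_ , refl) refl → (λ ()) , (λ ()) }) clique-fed AX-fed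
       ∷ fed-disjoint (λ { (_ , refl) refl → (λ ()) , (λ ()) }) clique-fed BX-fed ∷ [])
      ∷ (fed-disjoint (λ { refl refl → (λ ()) , (λ ()) }) AX-fed BX-fed ∷ [])
      ∷ [] ∷ []

    preys-unique : Unique (concat blocks)
    preys-unique = Unique.concat⁺ blocks-unique blocks-disjoint

    preys-length : length (concat blocks) ≡ suc n
    preys-length = cong (5 +_) (begin
      length (tabulate preyAX ++ tabulate preyBX ++ [])         ≡⟨ length-++ (tabulate preyAX) ⟩
      length (tabulate preyAX) + length (tabulate preyBX ++ []) ≡⟨ cong₂ _+_ (length-tabulate preyAX)
                                                                          (cong length (++-identityʳ (tabulate preyBX))) ⟩
      k + length (tabulate preyBX)                              ≡⟨ cong (k +_) (length-tabulate preyBX) ⟩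
      k + k                                                     ∎)
      where open ≡-Reasoning

proposition3p6 : (i j k l : ℕ) → 1 ≤ i → 1 ≤ j → 1 ≤ k → 1 ≤ l →
    k ≤ j → 2 ≤ k → k < i →
    ∃[ n ] ∃[ G ] (InFamily i j {n} G × ¬ InFamily k l {n} G)
proposition3p6 _ _ 0 _ _ _ _ _ _ ()       _
proposition3p6 _ _ 1 _ _ _ _ _ _ (s≤s ()) _
proposition3p6 i j 2 l _ _ _ _ k≤j _ k<i =
  4 , G₄ , competitionGraph∈family D₄ (IsIJDigraph-mono {D = D₄} k<i k≤j D₄-degrees) , G₄∉family l
proposition3p6 i j (suc (suc (suc m))) l _ _ _ _ k≤j _ k<i =
  n , G , G∈family k<i k≤j , G∉family l
  where open Construction m
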